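{- For every term $\mathfrak{t}$ of the Mockingbird CLS, the poset $\mathcal{P}(\mathfrak{t})$ is a finite lattice.
   Context: Terms over $\{{\rm M}\}$ are the smallest set containing the variables $\mathsf{x}_1,\mathsf{x}_2,\dots$, the symbol ${\rm M}$, and $(\mathfrak{t}_1\mathfrak{t}_2)$ for terms $\mathfrak{t}_1,\mathfrak{t}_2$ (application associates to the left). The rewrite relation $\Rightarrow$ is the smallest relation with ${\rm M}\,\mathfrak{s} \Rightarrow \mathfrak{s}\,\mathfrak{s}$ for every term $\mathfrak{s}$, closed under $\mathfrak{t}_1 \Rightarrow \mathfrak{t}_1'$ implies $\mathfrak{t}_1\mathfrak{t}_2 \Rightarrow \mathfrak{t}_1'\mathfrak{t}_2$ and $\mathfrak{t}_2\mathfrak{t}_1 \Rightarrow \mathfrak{t}_2\mathfrak{t}_1'$. Its reflexive-transitive closure $\preccurlyeq$ is a partial order on terms, and $\mathcal{P}(\mathfrak{t})$ denotes the set $\{\mathfrak{t}' : \mathfrak{t}\preccurlyeq\mathfrak{t}'\}$ ordered by $\preccurlyeq$. -}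

module Defs where

open import Data.Nat using (ℕ)
open import Data.Product using (Σ; ∃; _×_; proj₁)
open import Data.List using (List)
open import Data.List.Membership.Propositional using (_∈_)
open import Relation.Binary.PropositionalEquality using (_≡_)
open import Relation.Binary.Construct.Closure.ReflexiveTransitive using (Star)
open import Relation.Binary.Lattice.Structures using (IsLattice)
open import Algebra.Core using (Op₂)

infixl 9 _·_

data Term : Set where
  var : ℕ → Term
  M   : Term
  _·_ : Term → Term → Term

infix 4 _⇒_ _≼_

data _⇒_ : Term → Term → Set where
  M-rule : ∀ s → M · s ⇒ s · s
  appˡ   : ∀ {t₁ t₁′} t₂ → t₁ ⇒ t₁′ → t₁ · t₂ ⇒ t₁′ · t₂
  appʳ   : ∀ {t₁ t₁′} t₂ → t₁ ⇒ t₁′ → t₂ · t₁ ⇒ t₂ · t₁′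

_≼_ : Term → Term → Set
_≼_ = Star _⇒_

P : Term → Set
P t = Σ Term (λ t′ → t ≼ t′)

_≈P_ : ∀ {t} → P t → P t → Set
a ≈P b = proj₁ a ≡ proj₁ b

_≤P_ : ∀ {t} → P t → P t → Set
a ≤P b = proj₁ a ≼ proj₁ b

FiniteP : Term → Set
FiniteP t = ∃ λ (ts : List Term) → ∀ t′ → t ≼ t′ → t′ ∈ ts

IsLatticeP : Term → Set
IsLatticeP t = Σ (Op₂ (P t)) λ _∨_ → Σ (Op₂ (P t)) λ _∧_ →
  IsLattice (_≈P_ {t}) (_≤P_ {t}) _∨_ _∧_

module Submission where

-- Reachability has a structural description ⊑: a redex M b either stays, with b reduced
-- further, or fires into c d, where c and d are reducts of b reached independently.
-- Reading off the derivations of t ⊑ x gives an explicit finite list of the reducts of t,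
-- and two derivations t ⊑ x, t ⊑ y combine componentwise into a least common reduct of
-- x and y (an unfired M c meeting a fired c′ d′ is fired first).  So P(t) is a finite
-- poset with least element t and binary joins, and in such a poset the meet of x and y
-- is the join of their finitely many common lower bounds.

open import Defs
open import Algebra.Core using (Op₂)
import Data.Nat as ℕ
open import Data.Product as Product using (_×_; _,_; proj₁; proj₂; ∃; zip)
open import Data.Sum using (_⊎_; inj₁; inj₂)
open import Data.List using (List; [_]; _++_; map; filter; foldr; cartesianProductWith)
open import Data.List.Relation.Unary.All as All using (All; []; _∷_)
open import Data.List.Relation.Unary.All.Properties using (all-filter)
open import Data.List.Relation.Unary.Any as Any using (Any; here; there)
open import Data.List.Relation.Unary.Any.Properties using (filter⁺; lookup-result)
open import Data.List.Membership.Propositional using (_∈_)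
open import Data.List.Membership.Propositional.Properties
  using (∈-map⁺; ∈-++⁺ˡ; ∈-++⁺ʳ; ∈-cartesianProductWith⁺)
open import Relation.Binary.Core using (Rel)
open import Relation.Binary.Definitions using (Decidable; Minimum)
open import Relation.Binary.Structures using (IsPartialOrder)
open import Relation.Binary.Lattice.Definitions using (Supremum; Infimum)
open import Relation.Binary.PropositionalEquality using (_≡_; refl; cong; cong₂)
open import Relation.Binary.Construct.Closure.ReflexiveTransitive using (ε; _◅_; _◅◅_; gmap)
import Relation.Binary.Construct.Closure.ReflexiveTransitive.Properties as Star
import Relation.Binary.Construct.On as On
import Relation.Unary as U
open import Relation.Nullary.Decidable using (Dec; yes; no; map′; _×-dec_; _⊎-dec_)
open import Relation.Nullary.Negation using (contradiction)

module MeetsFromFiniteJoins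
  {a ℓ₁ ℓ₂} {A : Set a} {_≈_ : Rel A ℓ₁} {_≤_ : Rel A ℓ₂}
  (isPartialOrder : IsPartialOrder _≈_ _≤_) (_≤?_ : Decidable _≤_)
  (⊥ : A) (minimum : Minimum _≤_ ⊥) (_∨_ : Op₂ A) (supremum : Supremum _≤_ _∨_)
  (elements : List A) (enumerates : ∀ x → Any (x ≈_) elements)
  where

  open IsPartialOrder isPartialOrder

  ⋁ : List A → A
  ⋁ = foldr _∨_ ⊥

  ⋁-least : ∀ {xs u} → All (_≤ u) xs → ⋁ xs ≤ u
  ⋁-least {u = u} []           = minimum u
  ⋁-least {u = u} (x≤u ∷ xs≤u) = proj₂ (proj₂ (supremum _ _)) u x≤u (⋁-least xs≤u)

  ⋁-upper : ∀ {xs u} → Any (u ≈_) xs → u ≤ ⋁ xs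
  ⋁-upper (here u≈x)   = trans (reflexive u≈x) (proj₁ (supremum _ _))
  ⋁-upper (there u∈xs) = trans (⋁-upper u∈xs) (proj₁ (proj₂ (supremum _ _)))

  LowerBound : A → A → A → Set ℓ₂
  LowerBound x y z = z ≤ x × z ≤ y

  lowerBound? : ∀ x y → U.Decidable (LowerBound x y)
  lowerBound? x y z = z ≤? x ×-dec z ≤? y

  infixr 7 _∧_

  _∧_ : Op₂ A
  x ∧ y = ⋁ (filter (lowerBound? x y) elements)

  ∧-greatest : ∀ {x y z} → LowerBound x y z → z ≤ (x ∧ y)
  ∧-greatest {x} {y} {z} z≤x,y with filter⁺ (lowerBound? x y) (enumerates z)
  ... | inj₁ z∈lower = ⋁-upper z∈lower
  ... | inj₂ ¬lower  =
    contradiction (Product.map (≲-respˡ-≈ z≈w) (≲-respˡ-≈ z≈w) z≤x,y) ¬lower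
    where
    z≈w : z ≈ Any.lookup (enumerates z)
    z≈w = lookup-result (enumerates z)

  infimum : Infimum _≤_ _∧_
  infimum x y =
    ⋁-least (All.map proj₁ lower) ,
    ⋁-least (All.map proj₂ lower) ,
    λ _ z≤x z≤y → ∧-greatest (z≤x , z≤y)
    where
    lower : All (LowerBound x y) (filter (lowerBound? x y) elements)
    lower = all-filter (lowerBound? x y) elements

infix 4 _⊑_

data _⊑_ : Term → Term → Set where
  var  : ∀ {n} → var n ⊑ var n
  M    : M ⊑ M
  _·_  : ∀ {a b c d} → a ⊑ c → b ⊑ d → a · b ⊑ c · d
  fire : ∀ {b c d} → b ⊑ c → b ⊑ d → M · b ⊑ c · d

⊑-refl : ∀ x → x ⊑ x
⊑-refl (var n) = var
⊑-refl M       = M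
⊑-refl (a · b) = ⊑-refl a · ⊑-refl b

⊑-trans : ∀ {x y z} → x ⊑ y → y ⊑ z → x ⊑ z
⊑-trans var        var          = var
⊑-trans M          M            = M
⊑-trans (p · q)    (p′ · q′)    = ⊑-trans p p′ · ⊑-trans q q′
⊑-trans (M · q)    (fire p′ q′) = fire (⊑-trans q p′) (⊑-trans q q′)
⊑-trans (fire p q) (p′ · q′)    = fire (⊑-trans p p′) (⊑-trans q q′)
⊑-trans (fire p q) (fire p′ q′) = fire (⊑-trans q p′) (⊑-trans q q′)

⊑-antisym : ∀ {x y} → x ⊑ y → y ⊑ x → x ≡ y
⊑-antisym var        var         = refl
⊑-antisym M          M           = refl
⊑-antisym (p · q)    (p′ · q′)   = cong₂ _·_ (⊑-antisym p p′) (⊑-antisym q q′)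
⊑-antisym (M · q)    (fire _ q′) = cong (M ·_) (⊑-antisym q q′)
⊑-antisym (fire _ q) (M · q′)    = cong (M ·_) (⊑-antisym q q′)
⊑-antisym (fire _ q) (fire _ q′) = cong (M ·_) (⊑-antisym q q′)

⇒⇒⊑ : ∀ {x y} → x ⇒ y → x ⊑ y
⇒⇒⊑ (M-rule s) = fire (⊑-refl s) (⊑-refl s)
⇒⇒⊑ (appˡ t r) = ⇒⇒⊑ r · ⊑-refl t
⇒⇒⊑ (appʳ t r) = ⊑-refl t · ⇒⇒⊑ r

≼⇒⊑ : ∀ {x y} → x ≼ y → x ⊑ y
≼⇒⊑ ε        = ⊑-refl _
≼⇒⊑ (r ◅ rs) = ⊑-trans (⇒⇒⊑ r) (≼⇒⊑ rs)

·-mono-≼ : ∀ {a b c d} → a ≼ c → b ≼ d → a · b ≼ c · d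
·-mono-≼ {b = b} {c = c} p q = gmap (_· b) (appˡ b) p ◅◅ gmap (c ·_) (appʳ c) q

⊑⇒≼ : ∀ {x y} → x ⊑ y → x ≼ y
⊑⇒≼ var        = ε
⊑⇒≼ M          = ε
⊑⇒≼ (p · q)    = ·-mono-≼ (⊑⇒≼ p) (⊑⇒≼ q)
⊑⇒≼ (fire p q) = M-rule _ ◅ ·-mono-≼ (⊑⇒≼ p) (⊑⇒≼ q)

≼-isPartialOrder : IsPartialOrder _≡_ _≼_
≼-isPartialOrder = record
  { isPreorder = Star.isPreorder _⇒_
  ; antisym    = λ r s → ⊑-antisym (≼⇒⊑ r) (≼⇒⊑ s)
  }

M? : (a : Term) → Dec (a ≡ M)
M? (var _) = no λ ()
M? M       = yes refl
M? (_ · _) = no λ ()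

_⊑?_ : Decidable _⊑_
var m   ⊑? var n   = map′ (λ { refl → var }) (λ { var → refl }) (m ℕ.≟ n)
M       ⊑? M       = yes M
(a · b) ⊑? (c · d) = map′ from to ((a ⊑? c ⊎-dec M? a ×-dec b ⊑? c) ×-dec b ⊑? d)
  where
  from : (a ⊑ c ⊎ a ≡ M × b ⊑ c) × b ⊑ d → a · b ⊑ c · d
  from (inj₁ p , q)          = p · q
  from (inj₂ (refl , p) , q) = fire p q
  to : a · b ⊑ c · d → (a ⊑ c ⊎ a ≡ M × b ⊑ c) × b ⊑ d
  to (p · q)    = inj₁ p , q
  to (fire p q) = inj₂ (refl , p) , q
var _   ⊑? M       = no λ ()
var _   ⊑? (_ · _) = no λ ()
M       ⊑? var _   = no λ ()
M       ⊑? (_ · _) = no λ ()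
(_ · _) ⊑? var _   = no λ ()
(_ · _) ⊑? M       = no λ ()

_≼?_ : Decidable _≼_
x ≼? y = map′ ⊑⇒≼ ≼⇒⊑ (x ⊑? y)

reducts : (t : Term) → List (∃ (t ⊑_))
reducts (var n) = [ var n , var ]
reducts M       = [ M , M ]
reducts (M · b) =
  map (Product.map (M ·_) (M ·_)) (reducts b) ++
  cartesianProductWith (zip _·_ fire) (reducts b) (reducts b)
reducts (a · b) = cartesianProductWith (zip _·_ _·_) (reducts a) (reducts b)

∈-reducts : ∀ {t x} (p : t ⊑ x) → (x , p) ∈ reducts t
∈-reducts var                = here refl
∈-reducts M                  = here refl
∈-reducts (M · q)            = ∈-++⁺ˡ (∈-map⁺ _ (∈-reducts q))
∈-reducts (fire p q)         =
  ∈-++⁺ʳ _ (∈-cartesianProductWith⁺ (zip _·_ fire) (∈-reducts p) (∈-reducts q))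
∈-reducts (p@var · q)        = ∈-cartesianProductWith⁺ (zip _·_ _·_) (∈-reducts p) (∈-reducts q)
∈-reducts (p@(_ · _) · q)    = ∈-cartesianProductWith⁺ (zip _·_ _·_) (∈-reducts p) (∈-reducts q)
∈-reducts (p@(fire _ _) · q) = ∈-cartesianProductWith⁺ (zip _·_ _·_) (∈-reducts p) (∈-reducts q)

⊑M-⊑⇒⊑M : ∀ {b c} → b ⊑ M → b ⊑ c → c ⊑ M
⊑M-⊑⇒⊑M M M = M

⊑M-⊑⇒M⊑ : ∀ {b c} → b ⊑ M → b ⊑ c → M ⊑ c
⊑M-⊑⇒M⊑ M M = M

infixl 6 _⊔_

_⊔_ : ∀ {t x y} → t ⊑ x → t ⊑ y → Term
var {n}  ⊔ var        = var n
M        ⊔ M          = M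
(p · q)  ⊔ (p′ · q′)  = (p ⊔ p′) · (q ⊔ q′)
(M · q)  ⊔ fire p′ q′ = (q ⊔ p′) · (q ⊔ q′)
fire p q ⊔ (M · q′)   = (p ⊔ q′) · (q ⊔ q′)
fire p q ⊔ fire p′ q′ = (p ⊔ p′) · (q ⊔ q′)

⊔-upperˡ : ∀ {t x y} (r : t ⊑ x) (s : t ⊑ y) → x ⊑ r ⊔ s
⊔-upperˡ var        var          = var
⊔-upperˡ M          M            = M
⊔-upperˡ (p · q)    (p′ · q′)    = ⊔-upperˡ p p′ · ⊔-upperˡ q q′
⊔-upperˡ (M · q)    (fire p′ q′) = fire (⊔-upperˡ q p′) (⊔-upperˡ q q′)
⊔-upperˡ (fire p q) (M · q′)     = ⊔-upperˡ p q′ · ⊔-upperˡ q q′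
⊔-upperˡ (fire p q) (fire p′ q′) = ⊔-upperˡ p p′ · ⊔-upperˡ q q′

⊔-upperʳ : ∀ {t x y} (r : t ⊑ x) (s : t ⊑ y) → y ⊑ r ⊔ s
⊔-upperʳ var        var          = var
⊔-upperʳ M          M            = M
⊔-upperʳ (p · q)    (p′ · q′)    = ⊔-upperʳ p p′ · ⊔-upperʳ q q′
⊔-upperʳ (M · q)    (fire p′ q′) = ⊔-upperʳ q p′ · ⊔-upperʳ q q′
⊔-upperʳ (fire p q) (M · q′)     = fire (⊔-upperʳ p q′) (⊔-upperʳ q q′)
⊔-upperʳ (fire p q) (fire p′ q′) = ⊔-upperʳ p p′ · ⊔-upperʳ q q′

-- A fired reduct c′ d′ of M b lies below an unfired M w only if c′ = M, which forces
-- b = M and hence every reduct of b to be M; ⊑M-⊑⇒⊑M and ⊑M-⊑⇒M⊑ record this.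
⊔-least : ∀ {t x y z} (r : t ⊑ x) (s : t ⊑ y) → x ⊑ z → y ⊑ z → r ⊔ s ⊑ z
⊔-least var var xz _ = xz
⊔-least M   M   xz _ = xz
⊔-least (p · q) (p′ · q′) (xz₁ · xz₂) (yz₁ · yz₂) =
  ⊔-least p p′ xz₁ yz₁ · ⊔-least q q′ xz₂ yz₂
⊔-least (M · q) (M · q′) (M · xz₂) (fire _ yz₂) = M · ⊔-least q q′ xz₂ yz₂
⊔-least (M · q) (M · q′) (fire _ xz₂) (M · yz₂) = M · ⊔-least q q′ xz₂ yz₂
⊔-least (M · q) (M · q′) (fire xz₁ xz₂) (fire yz₁ yz₂) =
  fire (⊔-least q q′ xz₁ yz₁) (⊔-least q q′ xz₂ yz₂)
⊔-least (M · q) (fire p′ q′) (M · xz₂) (yz₁ · yz₂) =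
  ⊔-least q p′ (⊑M-⊑⇒⊑M (⊑-trans p′ yz₁) q) yz₁ · ⊔-least q q′ xz₂ yz₂
⊔-least (M · q) (fire p′ q′) (M · xz₂) (fire _ yz₂) =
  ⊔-least q p′ (⊑M-⊑⇒⊑M p′ q) M · ⊔-least q q′ xz₂ yz₂
⊔-least (M · q) (fire p′ q′) (fire xz₁ xz₂) (yz₁ · yz₂) =
  ⊔-least q p′ xz₁ yz₁ · ⊔-least q q′ xz₂ yz₂
⊔-least (M · q) (fire p′ q′) (fire xz₁ xz₂) (fire _ yz₂) =
  ⊔-least q p′ xz₁ (⊑M-⊑⇒M⊑ p′ (⊑-trans q xz₁)) · ⊔-least q q′ xz₂ yz₂
⊔-least (fire p q) (M · q′) (xz₁ · xz₂) (M · yz₂) =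
  ⊔-least p q′ xz₁ (⊑M-⊑⇒⊑M (⊑-trans p xz₁) q′) · ⊔-least q q′ xz₂ yz₂
⊔-least (fire p q) (M · q′) (fire _ xz₂) (M · yz₂) =
  ⊔-least p q′ M (⊑M-⊑⇒⊑M p q′) · ⊔-least q q′ xz₂ yz₂
⊔-least (fire p q) (M · q′) (xz₁ · xz₂) (fire yz₁ yz₂) =
  ⊔-least p q′ xz₁ yz₁ · ⊔-least q q′ xz₂ yz₂
⊔-least (fire p q) (M · q′) (fire _ xz₂) (fire yz₁ yz₂) =
  ⊔-least p q′ (⊑M-⊑⇒M⊑ p (⊑-trans q′ yz₁)) yz₁ · ⊔-least q q′ xz₂ yz₂
⊔-least (fire p q) (fire p′ q′) (xz₁ · xz₂) (yz₁ · yz₂) =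
  ⊔-least p p′ xz₁ yz₁ · ⊔-least q q′ xz₂ yz₂
⊔-least (fire p q) (fire p′ q′) (fire _ xz₂) (yz₁ · yz₂) =
  ⊔-least p p′ (⊑M-⊑⇒M⊑ p (⊑-trans p′ yz₁)) yz₁ · ⊔-least q q′ xz₂ yz₂
⊔-least (fire p q) (fire p′ q′) (xz₁ · xz₂) (fire _ yz₂) =
  ⊔-least p p′ xz₁ (⊑M-⊑⇒M⊑ p′ (⊑-trans p xz₁)) · ⊔-least q q′ xz₂ yz₂
⊔-least (fire p q) (fire p′ q′) (fire xz₁ xz₂) (fire yz₁ yz₂) =
  ⊔-least p p′ (⊑M-⊑⇒M⊑ p (⊑-trans q xz₁)) (⊑M-⊑⇒M⊑ p′ (⊑-trans q′ yz₁))
    · ⊔-least q q′ xz₂ yz₂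

finiteP : ∀ t → FiniteP t
finiteP t = map proj₁ (reducts t) , λ _ r → ∈-map⁺ proj₁ (∈-reducts (≼⇒⊑ r))

module _ (t : Term) where

  isPartialOrderP : IsPartialOrder (_≈P_ {t}) _≤P_
  isPartialOrderP = On.isPartialOrder proj₁ ≼-isPartialOrder

  _≤P?_ : Decidable (_≤P_ {t})
  x ≤P? y = proj₁ x ≼? proj₁ y

  minimumP : Minimum (_≤P_ {t}) (t , ε)
  minimumP = proj₂

  infixr 6 _∨_

  _∨_ : Op₂ (P t)
  (_ , r) ∨ (_ , s) = ≼⇒⊑ r ⊔ ≼⇒⊑ s , ⊑⇒≼ (⊑-trans (≼⇒⊑ r) (⊔-upperˡ (≼⇒⊑ r) (≼⇒⊑ s)))

  supremumP : Supremum _≤P_ _∨_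
  supremumP (_ , r) (_ , s) =
    ⊑⇒≼ (⊔-upperˡ (≼⇒⊑ r) (≼⇒⊑ s)) ,
    ⊑⇒≼ (⊔-upperʳ (≼⇒⊑ r) (≼⇒⊑ s)) ,
    λ _ x≼z y≼z → ⊑⇒≼ (⊔-least (≼⇒⊑ r) (≼⇒⊑ s) (≼⇒⊑ x≼z) (≼⇒⊑ y≼z))

  elementsP : List (P t)
  elementsP = map (Product.map₂ ⊑⇒≼) (reducts t)

  enumeratesP : ∀ x → Any (x ≈P_) elementsP
  enumeratesP (_ , r) =
    Any.map (cong proj₁) (∈-map⁺ (Product.map₂ ⊑⇒≼) (∈-reducts (≼⇒⊑ r)))

  open MeetsFromFiniteJoins isPartialOrderP _≤P?_ (t , ε) minimumP _∨_ supremumP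
    elementsP enumeratesP

  isLatticeP : IsLatticeP t
  isLatticeP = _∨_ , _∧_ , record
    { isPartialOrder = isPartialOrderP
    ; supremum       = supremumP
    ; infimum        = infimum
    }

theorem2p5 : ∀ (t : Term) → FiniteP t × IsLatticeP t
theorem2p5 t = finiteP t , isLatticeP t
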